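{- Let $\varphi\in\mathbb{Z}[x_0,x_1,x_2]$ be a homogeneous quadratic form, $\Phi$ the symmetric bilinear form with $\Phi(\underline{x},\underline{x})=2\varphi(\underline{x})$, and $\psi(\underline{x},\underline{y})=\Phi(\underline{x},\underline{y})\underline{x}-\varphi(\underline{x})\underline{y}$. Let $\underline{y}_{ -1},\underline{y}_0,\underline{y}_1\in\mathbb{Z}^3$ with $\varphi(\underline{y}_i)=1$ for $i=-1,0,1$, define $\underline{y}_{i+1}=\psi(\underline{y}_i,\underline{y}_{i-2})$ for $i\ge1$ and $t_i=\Phi(\underline{y}_{i+1},\underline{y}_i)$ for $i\ge-1$. Suppose that $1\le t_{ -1}<t_0<t_1$ and $1\le\|\underline{y}_{ -1}\|<\|\underline{y}_0\|<\|\underline{y}_1\|$. Then $(t_i)_{i\ge-1}$ and $(\|\underline{y}_i\|)_{i\ge-1}$ are strictly increasing sequences of positive integers with $t_{i+1}\asymp t_i^{\gamma}$ and $\|\underline{y}_{i+1}\|\asymp t_{i+2}\asymp\|\underline{y}_i\|^{\gamma}$.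
   Context: $\|\cdot\|$ is the maximum norm on $\mathbb{R}^3$; $\gamma=(1+\sqrt5)/2$. $A\asymp B$ means $K^{ -1}B\le A\le KB$ for a constant $K>0$ independent of $i$. -}

module Defs where

open import Data.Nat as N using (ℕ; zero; suc; _⊔_)
open import Data.Integer as Z using (ℤ; +_; ∣_∣)
open import Data.Product using (_×_; _,_; proj₁; proj₂)

V3 : Set
V3 = ℤ × ℤ × ℤ

record QForm : Set where
  constructor qform
  field
    a00 a11 a22 a01 a02 a12 : ℤ

module _ where
  open Z using (_+_; _*_; _-_)

  φ : QForm → V3 → ℤ
  φ (qform a00 a11 a22 a01 a02 a12) (x0 , x1 , x2) =
    a00 * x0 * x0 + a11 * x1 * x1 + a22 * x2 * x2
    + a01 * x0 * x1 + a02 * x0 * x2 + a12 * x1 * x2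

  _⊕_ : V3 → V3 → V3
  (x0 , x1 , x2) ⊕ (y0 , y1 , y2) = (x0 + y0 , x1 + y1 , x2 + y2)

  _·_ : ℤ → V3 → V3
  c · (x0 , x1 , x2) = (c * x0 , c * x1 , c * x2)

  _⊖_ : V3 → V3 → V3
  (x0 , x1 , x2) ⊖ (y0 , y1 , y2) = (x0 - y0 , x1 - y1 , x2 - y2)

  -- The symmetric bilinear form with Φ(x,x) = 2φ(x) (polarisation).
  Φ : QForm → V3 → V3 → ℤ
  Φ f x y = φ f (x ⊕ y) - φ f x - φ f y

  ψ : QForm → V3 → V3 → V3
  ψ f x y = (Φ f x y · x) ⊖ (φ f x · y)

‖_‖ : V3 → ℕ
‖ (x0 , x1 , x2) ‖ = ∣ x0 ∣ ⊔ ∣ x1 ∣ ⊔ ∣ x2 ∣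

-- The sequence with shifted index: Y f a b c n = y_{n-1}, where
-- y_{-1} = a, y_0 = b, y_1 = c and y_{i+1} = ψ(y_i, y_{i-2}) for i ≥ 1.
Y : QForm → V3 → V3 → V3 → ℕ → V3
Y f a b c zero = a
Y f a b c (suc zero) = b
Y f a b c (suc (suc zero)) = c
Y f a b c (suc (suc (suc n))) = ψ f (Y f a b c (suc (suc n))) (Y f a b c n)

-- T f a b c n = t_{n-1} = Φ(y_n, y_{n-1}).
T : QForm → V3 → V3 → V3 → ℕ → ℤ
T f a b c n = Φ f (Y f a b c (suc n)) (Y f a b c n)

module _ where
  open N using (_^_; _*_; _+_; _≤_; _<_)

  _≤[_]·_ : ℕ → ℕ → ℕ → Set
  A ≤[ K ]· B = A ≤ K * B

  _≍[_]_ : ℕ → ℕ → ℕ → Set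
  A ≍[ K ] B = (A ≤ K * B) × (B ≤ K * A)

  -- A ≤ K · B^γ, γ = (1+√5)/2, for B ≥ 1, expressed without reals:
  -- for every rational p/q > γ (i.e. p² > pq + q², q > 0), A^q ≤ K^q · B^p.
  _≤[_]·_^γ : ℕ → ℕ → ℕ → Set
  A ≤[ K ]· B ^γ = ∀ p q → 0 < q → q * q + p * q < p * p → A ^ q ≤ K ^ q * B ^ p

  -- B^γ ≤ K · A, expressed without reals:
  -- for every rational p/q < γ (i.e. p² < pq + q², q > 0), B^p ≤ K^q · A^q.
  _^γ≤[_]·_ : ℕ → ℕ → ℕ → Set
  B ^γ≤[ K ]· A = ∀ p q → 0 < q → p * p < p * q + q * q → B ^ p ≤ K ^ q * A ^ q

  _≍[_]_^γ : ℕ → ℕ → ℕ → Set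
  A ≍[ K ] B ^γ = (A ≤[ K ]· B ^γ) × (B ^γ≤[ K ]· A)

{-# OPTIONS --safe #-}
module Submission where

-- Since φ(ψ(x, y)) = φ(x)² φ(y) and Φ(ψ(x, y), x) = φ(x) Φ(x, y), every y_i has φ(y_i) = 1 and the
-- recursion becomes linear: y_{i+1} = t_i y_i − y_{i−2} and t_{i+1} = t_i t_{i−1} − t_{i−2}. Hence
-- t_{i+1} ≍ t_i t_{i−1}, and ‖y_{i+1}‖ differs from t_i ‖y_i‖ by at most ‖y_{i−2}‖. The ratio
-- ‖y_i‖ / t_{i+1} thus changes at each step by a factor 1 + O(1/t_i); since t grows doubly
-- exponentially these factors have a convergent product, so ‖y_i‖ ≍ t_{i+1}. Finally, a positive
-- nondecreasing sequence with u_{n+2} ≍ u_{n+1} u_n satisfies u_{n+1} ≍ u_n^γ: for p/q > γ one bounds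
-- u_{n+1}^q by u_n^p (and conversely for p/q < γ) by induction on n, the exponent pair passing from
-- (q + r, q) to (q, r) because γ = 1 + 1/γ.

open import Defs
open import Data.Nat using (ℕ; suc; _≤_; _<_)
open import Data.Integer using (ℤ; +_; ∣_∣) renaming (_<_ to _<ℤ_; _≤_ to _≤ℤ_)
open import Data.Product using (_×_; Σ; _,_; proj₁; proj₂)
open import Relation.Binary.PropositionalEquality
  using (_≡_; refl; sym; trans; cong; cong₂; subst; subst₂; module ≡-Reasoning)
open import Relation.Nullary using (yes; no; contradiction)
import Data.Nat as ℕ
import Data.Nat.Properties as ℕ
import Data.Integer as ℤ
import Data.Integer.Properties as ℤ

module QuadraticForm where
  open Data.Integer using (_+_; _*_; _-_)
  open import Data.Integer.Tactic.RingSolver using (solve-∀)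

  private
    φ-combination-polynomial : ∀ a00 a11 a22 a01 a02 a12 x0 x1 x2 y0 y1 y2 k m →
      let q u v w = a00 * u * u + a11 * v * v + a22 * w * w + a01 * u * v + a02 * u * w + a12 * v * w
      in q (k * x0 - m * y0) (k * x1 - m * y1) (k * x2 - m * y2)
         ≡ k * k * q x0 x1 x2 - k * m * (q (x0 + y0) (x1 + y1) (x2 + y2) - q x0 x1 x2 - q y0 y1 y2)
           + m * m * q y0 y1 y2
    φ-combination-polynomial = solve-∀

    Φ-combination-polynomial : ∀ a00 a11 a22 a01 a02 a12 x0 x1 x2 y0 y1 y2 z0 z1 z2 k m →
      let q u v w = a00 * u * u + a11 * v * v + a22 * w * w + a01 * u * v + a02 * u * w + a12 * v * w
          b u0 u1 u2 v0 v1 v2 = q (u0 + v0) (u1 + v1) (u2 + v2) - q u0 u1 u2 - q v0 v1 v2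
      in b (k * x0 - m * y0) (k * x1 - m * y1) (k * x2 - m * y2) z0 z1 z2
         ≡ k * b x0 x1 x2 z0 z1 z2 - m * b y0 y1 y2 z0 z1 z2
    Φ-combination-polynomial = solve-∀

    Φ-diag-polynomial : ∀ a00 a11 a22 a01 a02 a12 x0 x1 x2 →
      let q u v w = a00 * u * u + a11 * v * v + a22 * w * w + a01 * u * v + a02 * u * w + a12 * v * w
      in q (x0 + x0) (x1 + x1) (x2 + x2) - q x0 x1 x2 - q x0 x1 x2 ≡ + 2 * q x0 x1 x2
    Φ-diag-polynomial = solve-∀

    sub-swap : ∀ a b c → a - b - c ≡ a - c - b
    sub-swap = solve-∀

    ψ-expansion : ∀ s p r → s * s * p - s * p * s + p * p * r ≡ p * p * r
    ψ-expansion = solve-∀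

    ψ-pairing : ∀ s p → s * (+ 2 * p) - p * s ≡ p * s
    ψ-pairing = solve-∀

  φ-combination : ∀ f k m x y →
                  φ f ((k · x) ⊖ (m · y)) ≡ k * k * φ f x - k * m * Φ f x y + m * m * φ f y
  φ-combination (qform a00 a11 a22 a01 a02 a12) k m (x0 , x1 , x2) (y0 , y1 , y2) =
    φ-combination-polynomial a00 a11 a22 a01 a02 a12 x0 x1 x2 y0 y1 y2 k m

  Φ-combinationˡ : ∀ f k m x y z → Φ f ((k · x) ⊖ (m · y)) z ≡ k * Φ f x z - m * Φ f y z
  Φ-combinationˡ (qform a00 a11 a22 a01 a02 a12) k m (x0 , x1 , x2) (y0 , y1 , y2) (z0 , z1 , z2) =
    Φ-combination-polynomial a00 a11 a22 a01 a02 a12 x0 x1 x2 y0 y1 y2 z0 z1 z2 k m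

  Φ-diag : ∀ f x → Φ f x x ≡ + 2 * φ f x
  Φ-diag (qform a00 a11 a22 a01 a02 a12) (x0 , x1 , x2) = Φ-diag-polynomial a00 a11 a22 a01 a02 a12 x0 x1 x2

  ⊕-comm : ∀ x y → x ⊕ y ≡ y ⊕ x
  ⊕-comm (x0 , x1 , x2) (y0 , y1 , y2) =
    cong₂ _,_ (ℤ.+-comm x0 y0) (cong₂ _,_ (ℤ.+-comm x1 y1) (ℤ.+-comm x2 y2))

  Φ-sym : ∀ f x y → Φ f x y ≡ Φ f y x
  Φ-sym f x y = trans (cong (λ z → φ f z - φ f x - φ f y) (⊕-comm x y)) (sub-swap (φ f (y ⊕ x)) (φ f x) (φ f y))

  φ-ψ : ∀ f x y → φ f (ψ f x y) ≡ φ f x * φ f x * φ f y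
  φ-ψ f x y = trans (φ-combination f (Φ f x y) (φ f x) x y) (ψ-expansion (Φ f x y) (φ f x) (φ f y))

  Φ-ψ : ∀ f x y → Φ f (ψ f x y) x ≡ φ f x * Φ f x y
  Φ-ψ f x y = begin
    Φ f (ψ f x y) x                            ≡⟨ Φ-combinationˡ f (Φ f x y) (φ f x) x y x ⟩
    Φ f x y * Φ f x x - φ f x * Φ f y x        ≡⟨ cong₂ (λ u v → Φ f x y * u - φ f x * v) (Φ-diag f x) (Φ-sym f y x) ⟩
    Φ f x y * (+ 2 * φ f x) - φ f x * Φ f x y  ≡⟨ ψ-pairing (Φ f x y) (φ f x) ⟩
    φ f x * Φ f x y                            ∎
    where open ≡-Reasoning

open QuadraticForm

module Recurrence (f : QForm) (a b c : V3) (φa≡1 : φ f a ≡ + 1) (φb≡1 : φ f b ≡ + 1) (φc≡1 : φ f c ≡ + 1) where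
  open Data.Nat using (_+_)
  open Data.Integer using (_*_; _-_)
  open ≡-Reasoning

  private
    y : ℕ → V3
    y = Y f a b c

    t : ℕ → ℤ
    t = T f a b c

  φ-Y≡1 : ∀ n → φ f (y n) ≡ + 1
  φ-Y≡1 0 = φa≡1
  φ-Y≡1 1 = φb≡1
  φ-Y≡1 2 = φc≡1
  φ-Y≡1 (suc (suc (suc n))) = begin
    φ f (ψ f (y (2 + n)) (y n))                    ≡⟨ φ-ψ f (y (2 + n)) (y n) ⟩
    φ f (y (2 + n)) * φ f (y (2 + n)) * φ f (y n)  ≡⟨ cong₂ (λ u v → u * u * v) (φ-Y≡1 (suc (suc n))) (φ-Y≡1 n) ⟩
    + 1                                            ∎

  T-skip : ∀ n → t (2 + n) ≡ Φ f (y (2 + n)) (y n)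
  T-skip n = begin
    Φ f (ψ f (y (2 + n)) (y n)) (y (2 + n))  ≡⟨ Φ-ψ f (y (2 + n)) (y n) ⟩
    φ f (y (2 + n)) * Φ f (y (2 + n)) (y n)  ≡⟨ cong (_* Φ f (y (2 + n)) (y n)) (φ-Y≡1 (2 + n)) ⟩
    + 1 * Φ f (y (2 + n)) (y n)              ≡⟨ ℤ.*-identityˡ _ ⟩
    Φ f (y (2 + n)) (y n)                    ∎

  Y-rec : ∀ n → y (3 + n) ≡ (t (2 + n) · y (2 + n)) ⊖ ((+ 1) · y n)
  Y-rec n = cong₂ (λ u v → (u · y (2 + n)) ⊖ (v · y n)) (sym (T-skip n)) (φ-Y≡1 (2 + n))

  T-rec : ∀ n → t (3 + n) ≡ t (2 + n) * t (1 + n) - t n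
  T-rec n = begin
    t (3 + n)                                               ≡⟨ T-skip (1 + n) ⟩
    Φ f (y (3 + n)) (y (1 + n))                             ≡⟨ cong (λ z → Φ f z (y (1 + n))) (Y-rec n) ⟩
    Φ f ((t (2 + n) · y (2 + n)) ⊖ ((+ 1) · y n)) (y (1 + n)) ≡⟨ Φ-combinationˡ f (t (2 + n)) (+ 1) _ _ _ ⟩
    t (2 + n) * t (1 + n) - + 1 * Φ f (y n) (y (1 + n))     ≡⟨ cong (λ v → t (2 + n) * t (1 + n) - v)
                                                                    (trans (ℤ.*-identityˡ _) (Φ-sym f (y n) (y (1 + n)))) ⟩
    t (2 + n) * t (1 + n) - t n                             ∎

module MaxNorm where
  open Data.Nat using (_+_; _*_; _⊔_)
  open import Data.Nat.Properties using (≤-trans; +-mono-≤; ⊔-lub; m≤m⊔n; m≤n⊔m; *-distribˡ-⊔)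
  open Data.Integer using (_-_)
  open import Data.Integer.Properties using (∣i-j∣≤∣i∣+∣j∣; ∣i+j∣≤∣i∣+∣j∣; ∣i*j∣≡∣i∣*∣j∣)
  open import Data.Integer.Tactic.RingSolver using (solve-∀)

  ‖‖-lub : ∀ x0 x1 x2 {B} → ∣ x0 ∣ ≤ B → ∣ x1 ∣ ≤ B → ∣ x2 ∣ ≤ B → ‖ (x0 , x1 , x2) ‖ ≤ B
  ‖‖-lub _ _ _ x0≤B x1≤B x2≤B = ⊔-lub (⊔-lub x0≤B x1≤B) x2≤B

  ∣x₀∣≤‖x‖ : ∀ x0 x1 x2 → ∣ x0 ∣ ≤ ‖ (x0 , x1 , x2) ‖
  ∣x₀∣≤‖x‖ x0 x1 x2 = ≤-trans (m≤m⊔n (∣ x0 ∣) (∣ x1 ∣)) (m≤m⊔n _ (∣ x2 ∣))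

  ∣x₁∣≤‖x‖ : ∀ x0 x1 x2 → ∣ x1 ∣ ≤ ‖ (x0 , x1 , x2) ‖
  ∣x₁∣≤‖x‖ x0 x1 x2 = ≤-trans (m≤n⊔m (∣ x0 ∣) (∣ x1 ∣)) (m≤m⊔n _ (∣ x2 ∣))

  ∣x₂∣≤‖x‖ : ∀ x0 x1 x2 → ∣ x2 ∣ ≤ ‖ (x0 , x1 , x2) ‖
  ∣x₂∣≤‖x‖ x0 x1 x2 = m≤n⊔m (∣ x0 ∣ ⊔ ∣ x1 ∣) (∣ x2 ∣)

  ‖·‖ : ∀ k x → ‖ k · x ‖ ≡ ∣ k ∣ * ‖ x ‖
  ‖·‖ k (x0 , x1 , x2) = begin
    ∣ k ℤ.* x0 ∣ ⊔ ∣ k ℤ.* x1 ∣ ⊔ ∣ k ℤ.* x2 ∣       ≡⟨ cong₂ _⊔_ (cong₂ _⊔_ (∣i*j∣≡∣i∣*∣j∣ k x0) (∣i*j∣≡∣i∣*∣j∣ k x1))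
                                                                (∣i*j∣≡∣i∣*∣j∣ k x2) ⟩
    ∣ k ∣ * ∣ x0 ∣ ⊔ ∣ k ∣ * ∣ x1 ∣ ⊔ ∣ k ∣ * ∣ x2 ∣ ≡⟨ cong (_⊔ ∣ k ∣ * ∣ x2 ∣) (sym (*-distribˡ-⊔ (∣ k ∣) (∣ x0 ∣) (∣ x1 ∣))) ⟩
    ∣ k ∣ * (∣ x0 ∣ ⊔ ∣ x1 ∣) ⊔ ∣ k ∣ * ∣ x2 ∣       ≡⟨ sym (*-distribˡ-⊔ (∣ k ∣) (∣ x0 ∣ ⊔ ∣ x1 ∣) (∣ x2 ∣)) ⟩
    ∣ k ∣ * (∣ x0 ∣ ⊔ ∣ x1 ∣ ⊔ ∣ x2 ∣)               ∎
    where open ≡-Reasoning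

  ‖⊖‖≤‖‖+‖‖ : ∀ x y → ‖ x ⊖ y ‖ ≤ ‖ x ‖ + ‖ y ‖
  ‖⊖‖≤‖‖+‖‖ x@(x0 , x1 , x2) y@(y0 , y1 , y2) =
    ‖‖-lub (x0 - y0) (x1 - y1) (x2 - y2)
      (bound x0 y0 (∣x₀∣≤‖x‖ x0 x1 x2) (∣x₀∣≤‖x‖ y0 y1 y2))
      (bound x1 y1 (∣x₁∣≤‖x‖ x0 x1 x2) (∣x₁∣≤‖x‖ y0 y1 y2))
      (bound x2 y2 (∣x₂∣≤‖x‖ x0 x1 x2) (∣x₂∣≤‖x‖ y0 y1 y2))
    where
      bound : ∀ i j → ∣ i ∣ ≤ ‖ x ‖ → ∣ j ∣ ≤ ‖ y ‖ → ∣ i - j ∣ ≤ ‖ x ‖ + ‖ y ‖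
      bound i j i≤x j≤y = ≤-trans (∣i-j∣≤∣i∣+∣j∣ i j) (+-mono-≤ i≤x j≤y)

  ‖‖≤‖⊖‖+‖‖ : ∀ x y → ‖ x ‖ ≤ ‖ x ⊖ y ‖ + ‖ y ‖
  ‖‖≤‖⊖‖+‖‖ x@(x0 , x1 , x2) y@(y0 , y1 , y2) =
    ‖‖-lub x0 x1 x2
      (bound x0 y0 (∣x₀∣≤‖x‖ (x0 - y0) (x1 - y1) (x2 - y2)) (∣x₀∣≤‖x‖ y0 y1 y2))
      (bound x1 y1 (∣x₁∣≤‖x‖ (x0 - y0) (x1 - y1) (x2 - y2)) (∣x₁∣≤‖x‖ y0 y1 y2))
      (bound x2 y2 (∣x₂∣≤‖x‖ (x0 - y0) (x1 - y1) (x2 - y2)) (∣x₂∣≤‖x‖ y0 y1 y2))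
    where
      sub-add : ∀ i j → i ≡ i - j ℤ.+ j
      sub-add = solve-∀

      bound : ∀ i j → ∣ i - j ∣ ≤ ‖ x ⊖ y ‖ → ∣ j ∣ ≤ ‖ y ‖ → ∣ i ∣ ≤ ‖ x ⊖ y ‖ + ‖ y ‖
      bound i j i-j≤ j≤y = subst (λ k → ∣ k ∣ ≤ ‖ x ⊖ y ‖ + ‖ y ‖) (sym (sub-add i j))
                                 (≤-trans (∣i+j∣≤∣i∣+∣j∣ (i - j) j) (+-mono-≤ i-j≤ j≤y))

  ‖·⊖·‖≤ : ∀ k m x y → ‖ (k · x) ⊖ (m · y) ‖ ≤ ∣ k ∣ * ‖ x ‖ + ∣ m ∣ * ‖ y ‖
  ‖·⊖·‖≤ k m x y = subst₂ (λ u v → ‖ (k · x) ⊖ (m · y) ‖ ≤ u + v) (‖·‖ k x) (‖·‖ m y)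
                          (‖⊖‖≤‖‖+‖‖ (k · x) (m · y))

  ‖‖≤‖·⊖·‖+ : ∀ k m x y → ∣ k ∣ * ‖ x ‖ ≤ ‖ (k · x) ⊖ (m · y) ‖ + ∣ m ∣ * ‖ y ‖
  ‖‖≤‖·⊖·‖+ k m x y = subst₂ (λ u v → u ≤ ‖ (k · x) ⊖ (m · y) ‖ + v) (‖·‖ k x) (‖·‖ m y)
                             (‖‖≤‖⊖‖+‖‖ (k · x) (m · y))

module IntegerGrowth where
  open Data.Integer using (_+_; _*_; _-_; -_; -[1+_])
  open import Data.Integer.Base using (+≤+; +<+)
  open import Data.Integer.Tactic.RingSolver using (solve-∀)

  private
    add-sub : ∀ i j → i + j - j ≡ i
    add-sub = solve-∀

    ℕ-growth-step : ∀ p q r → 1 ≤ p → p < q → q < r → r ℕ.+ p < r ℕ.* q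
    ℕ-growth-step p q r 1≤p p<q q<r = begin-strict
      r ℕ.+ p  <⟨ ℕ.+-monoʳ-< r (ℕ.<-trans p<q q<r) ⟩
      r ℕ.+ r  ≡⟨ cong (r ℕ.+_) (sym (ℕ.+-identityʳ r)) ⟩
      2 ℕ.* r  ≤⟨ ℕ.*-monoˡ-≤ r (ℕ.≤-<-trans 1≤p p<q) ⟩
      q ℕ.* r  ≡⟨ ℕ.*-comm q r ⟩
      r ℕ.* q  ∎
      where open ℕ.≤-Reasoning

  growth-step : ∀ p q r → + 1 ≤ℤ p → p <ℤ q → q <ℤ r → r <ℤ r * q - p
  growth-step -[1+ _ ] _        _        ()        _         _
  growth-step (+ _)    -[1+ _ ] _        _         ()        _
  growth-step (+ _)    (+ _)    -[1+ _ ] _         _         ()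
  growth-step (+ p)    (+ q)    (+ r)    (+≤+ 1≤p) (+<+ p<q) (+<+ q<r) = begin-strict
    + r                ≡⟨ sym (add-sub (+ r) (+ p)) ⟩
    + r + + p - + p    <⟨ ℤ.+-monoˡ-< (- + p) (+<+ (ℕ-growth-step p q r 1≤p p<q q<r)) ⟩
    + (r ℕ.* q) - + p  ≡⟨ cong (_- + p) (ℤ.pos-* r q) ⟩
    + r * + q - + p    ∎
    where open ℤ.≤-Reasoning

module IntegerSequences (f : QForm) (a b c : V3)
  (φa≡1 : φ f a ≡ + 1) (φb≡1 : φ f b ≡ + 1) (φc≡1 : φ f c ≡ + 1)
  (1≤T₀ : + 1 ≤ℤ T f a b c 0) (T₀<T₁ : T f a b c 0 <ℤ T f a b c 1) (T₁<T₂ : T f a b c 1 <ℤ T f a b c 2) where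
  open Data.Nat using (_+_; _*_)
  open import Data.Integer.Base using (+≤+)
  open import Data.Integer.Tactic.RingSolver using (solve-∀)
  open Recurrence f a b c φa≡1 φb≡1 φc≡1
  open IntegerGrowth
  open MaxNorm

  private
    y : ℕ → V3
    y = Y f a b c

    t : ℕ → ℤ
    t = T f a b c

  T-step : ∀ n → + 1 ≤ℤ t n × t n <ℤ t (1 + n) → t (1 + n) <ℤ t (2 + n) →
           + 1 ≤ℤ t (2 + n) × t (2 + n) <ℤ t (3 + n)
  T-step n (1≤tₙ , tₙ<tₙ₊₁) tₙ₊₁<tₙ₊₂ =
      ℤ.≤-trans 1≤tₙ (ℤ.<⇒≤ (ℤ.<-trans tₙ<tₙ₊₁ tₙ₊₁<tₙ₊₂))
    , subst (t (2 + n) <ℤ_) (sym (T-rec n)) (growth-step (t n) (t (1 + n)) (t (2 + n)) 1≤tₙ tₙ<tₙ₊₁ tₙ₊₁<tₙ₊₂)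

  T-increasing : ∀ n → + 1 ≤ℤ t n × t n <ℤ t (suc n)
  T-increasing 0 = 1≤T₀ , T₀<T₁
  T-increasing 1 = ℤ.<⇒≤ (ℤ.≤-<-trans 1≤T₀ T₀<T₁) , T₁<T₂
  T-increasing (suc (suc n)) = T-step n (T-increasing n) (proj₂ (T-increasing (suc n)))

  tℕ : ℕ → ℕ
  tℕ n = ∣ t n ∣

  +tℕ≡t : ∀ n → + tℕ n ≡ t n
  +tℕ≡t n = ℤ.0≤i⇒+∣i∣≡i (ℤ.≤-trans (+≤+ ℕ.z≤n) (proj₁ (T-increasing n)))

  1≤tℕ₀ : 1 ≤ tℕ 0
  1≤tℕ₀ = ℤ.drop‿+≤+ (subst (+ 1 ≤ℤ_) (sym (+tℕ≡t 0)) 1≤T₀)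

  tℕ-increasing : ∀ n → tℕ n < tℕ (suc n)
  tℕ-increasing n = ℤ.drop‿+<+ (subst₂ _<ℤ_ (sym (+tℕ≡t n)) (sym (+tℕ≡t (suc n))) (proj₂ (T-increasing n)))

  tℕ-rec : ∀ n → tℕ (3 + n) + tℕ n ≡ tℕ (2 + n) * tℕ (1 + n)
  tℕ-rec n = ℤ.+-injective (begin
    + tℕ (3 + n) ℤ.+ + tℕ n                  ≡⟨ cong₂ ℤ._+_ (+tℕ≡t (3 + n)) (+tℕ≡t n) ⟩
    t (3 + n) ℤ.+ t n                        ≡⟨ cong (λ z → z ℤ.+ t n) (T-rec n) ⟩
    t (2 + n) ℤ.* t (1 + n) ℤ.- t n ℤ.+ t n  ≡⟨ sub-add (t (2 + n) ℤ.* t (1 + n)) (t n) ⟩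
    t (2 + n) ℤ.* t (1 + n)                  ≡⟨ sym (cong₂ ℤ._*_ (+tℕ≡t (2 + n)) (+tℕ≡t (1 + n))) ⟩
    + tℕ (2 + n) ℤ.* + tℕ (1 + n)            ≡⟨ sym (ℤ.pos-* (tℕ (2 + n)) (tℕ (1 + n))) ⟩
    + (tℕ (2 + n) * tℕ (1 + n))              ∎)
    where
      open ≡-Reasoning
      sub-add : ∀ i j → i ℤ.- j ℤ.+ j ≡ i
      sub-add = solve-∀

  Y-rec-ℕ : ∀ n → y (3 + n) ≡ ((+ tℕ (2 + n)) · y (2 + n)) ⊖ ((+ 1) · y n)
  Y-rec-ℕ n = trans (Y-rec n) (cong (λ k → (k · y (2 + n)) ⊖ ((+ 1) · y n)) (sym (+tℕ≡t (2 + n))))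

  ‖Y‖-rec-upper : ∀ n → ‖ y (3 + n) ‖ ≤ tℕ (2 + n) * ‖ y (2 + n) ‖ + ‖ y n ‖
  ‖Y‖-rec-upper n = begin
    ‖ y (3 + n) ‖                                     ≡⟨ cong ‖_‖ (Y-rec-ℕ n) ⟩
    ‖ ((+ tℕ (2 + n)) · y (2 + n)) ⊖ ((+ 1) · y n) ‖  ≤⟨ ‖·⊖·‖≤ (+ tℕ (2 + n)) (+ 1) (y (2 + n)) (y n) ⟩
    tℕ (2 + n) * ‖ y (2 + n) ‖ + 1 * ‖ y n ‖          ≡⟨ cong (λ v → tℕ (2 + n) * ‖ y (2 + n) ‖ + v) (ℕ.*-identityˡ ‖ y n ‖) ⟩
    tℕ (2 + n) * ‖ y (2 + n) ‖ + ‖ y n ‖              ∎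
    where open ℕ.≤-Reasoning

  ‖Y‖-rec-lower : ∀ n → tℕ (2 + n) * ‖ y (2 + n) ‖ ≤ ‖ y (3 + n) ‖ + ‖ y n ‖
  ‖Y‖-rec-lower n = begin
    tℕ (2 + n) * ‖ y (2 + n) ‖                                    ≤⟨ ‖‖≤‖·⊖·‖+ (+ tℕ (2 + n)) (+ 1) (y (2 + n)) (y n) ⟩
    ‖ ((+ tℕ (2 + n)) · y (2 + n)) ⊖ ((+ 1) · y n) ‖ + 1 * ‖ y n ‖ ≡⟨ cong₂ _+_ (cong ‖_‖ (sym (Y-rec-ℕ n))) (ℕ.*-identityˡ ‖ y n ‖) ⟩
    ‖ y (3 + n) ‖ + ‖ y n ‖                                       ∎
    where open ℕ.≤-Reasoning

module Naturals where
  open import Data.Nat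
  open import Data.Nat.Properties
  open import Data.Nat.Tactic.RingSolver using (solve; solve-∀)
  open import Data.List using (_∷_; [])
  open import Data.Sum using (inj₁; inj₂)

  module GoldenRatio where
    γ<_/_ : ℕ → ℕ → Set
    γ< p / q = q * q + p * q < p * p

    _/_<γ : ℕ → ℕ → Set
    p / q <γ = p * p < p * q + q * q

    γ<⇒≤ : ∀ p q → γ< p / q → q ≤ p
    γ<⇒≤ p q h with q ≤? p
    ... | yes q≤p = q≤p
    ... | no q≰p = contradiction h (≤⇒≯ (begin
          p * p          ≤⟨ *-monoʳ-≤ p (<⇒≤ (≰⇒> q≰p)) ⟩
          p * q          ≤⟨ m≤n+m (p * q) (q * q) ⟩
          q * q + p * q  ∎))
      where open ≤-Reasoning

    <γ⇒<2* : ∀ p q → p / q <γ → p < q + q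
    <γ⇒<2* p q h with q + q ≤? p
    ... | no 2q≰p = ≰⇒> 2q≰p
    ... | yes 2q≤p = contradiction h (≤⇒≯ (begin
          p * q + q * q  ≤⟨ +-monoʳ-≤ (p * q) (*-monoˡ-≤ q (≤-trans (m≤m+n q q) 2q≤p)) ⟩
          p * q + p * q  ≡⟨ sym (*-distribˡ-+ p q q) ⟩
          p * (q + q)    ≤⟨ *-monoʳ-≤ p 2q≤p ⟩
          p * p          ∎))
      where open ≤-Reasoning

    private
      step-identityˡ : ∀ q r → q * q + (q + r) * q ≡ (q * q + q * r) + q * q
      step-identityˡ = solve-∀

      step-identityʳ : ∀ q r → (q + r) * (q + r) ≡ (q * q + q * r) + (q * r + r * r)
      step-identityʳ = solve-∀

    -- γ = 1 + 1/γ: (q + r)/q lies above γ exactly when q/r lies below it.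
    γ<-step : ∀ q r → γ< (q + r) / q → q / r <γ
    γ<-step q r h = +-cancelˡ-< (q * q + q * r) _ _
      (subst₂ _<_ (step-identityˡ q r) (step-identityʳ q r) h)

    <γ-step : ∀ q r → (q + r) / q <γ → γ< q / r
    <γ-step q r h = +-cancelˡ-< (q * q + q * r) _ _
      (subst₂ _<_ (trans (step-identityʳ q r) (cong (λ z → q * q + q * r + z) (+-comm (q * r) (r * r))))
                  (trans (+-comm ((q + r) * q) (q * q)) (step-identityˡ q r)) h)

  module Comparability where
    ≍-sym : ∀ {A B K} → A ≍[ K ] B → B ≍[ K ] A
    ≍-sym (A≤KB , B≤KA) = B≤KA , A≤KB

    ≍-mono : ∀ {A B K L} → K ≤ L → A ≍[ K ] B → A ≍[ L ] B
    ≍-mono {A} {B} K≤L (A≤KB , B≤KA) = ≤-trans A≤KB (*-monoˡ-≤ B K≤L) , ≤-trans B≤KA (*-monoˡ-≤ A K≤L)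

    ≍-trans : ∀ {A B C K L} → A ≍[ K ] B → B ≍[ L ] C → A ≍[ K * L ] C
    ≍-trans {A} {B} {C} {K} {L} (A≤KB , B≤KA) (B≤LC , C≤LB) =
        ≤-trans A≤KB (≤-trans (*-monoʳ-≤ K B≤LC) (≤-reflexive (sym (*-assoc K L C))))
      , ≤-trans C≤LB (≤-trans (*-monoʳ-≤ L B≤KA) (≤-reflexive (rearrange L K A)))
      where
        rearrange : ∀ L K A → L * (K * A) ≡ K * L * A
        rearrange = solve-∀

    ≍-* : ∀ {A B C D K L} → A ≍[ K ] B → C ≍[ L ] D → (A * C) ≍[ K * L ] (B * D)
    ≍-* {A} {B} {C} {D} {K} {L} (A≤KB , B≤KA) (C≤LD , D≤LC) =
        ≤-trans (*-mono-≤ A≤KB C≤LD) (≤-reflexive (rearrange K B L D))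
      , ≤-trans (*-mono-≤ B≤KA D≤LC) (≤-reflexive (rearrange K A L C))
      where
        rearrange : ∀ K B L D → K * B * (L * D) ≡ K * L * (B * D)
        rearrange = solve-∀

    ≍^γ-mono : ∀ {A B K L} → K ≤ L → A ≍[ K ] B ^γ → A ≍[ L ] B ^γ
    ≍^γ-mono {A} {B} K≤L (A≤KBγ , Bγ≤KA) =
        (λ p q q>0 h → ≤-trans (A≤KBγ p q q>0 h) (*-monoˡ-≤ (B ^ p) (^-monoˡ-≤ q K≤L)))
      , (λ p q q>0 h → ≤-trans (Bγ≤KA p q q>0 h) (*-monoˡ-≤ (A ^ q) (^-monoˡ-≤ q K≤L)))

    ProductRecurrent : ℕ → (ℕ → ℕ) → Set
    ProductRecurrent D u = ∀ n → u (2 + n) ≍[ D ] (u (1 + n) * u n)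

    product-recurrent-from-1 : ∀ {u D} → (∀ n → 1 ≤ u n) → (∀ n → u (3 + n) ≍[ D ] (u (2 + n) * u (1 + n))) →
                               ProductRecurrent (D + u 2 + u 1 * u 0) u
    product-recurrent-from-1 {u} {D} u-positive u-≍ zero =
        ≤-trans (≤-trans (m≤n+m (u 2) D) (m≤m+n _ (u 1 * u 0)))
                (m≤m*n _ (u 1 * u 0) {{m*n≢0 (u 1) (u 0) {{u-nonZero 1}} {{u-nonZero 0}}}})
      , ≤-trans (m≤n+m (u 1 * u 0) (D + u 2)) (m≤m*n _ (u 2) {{u-nonZero 2}})
      where
        u-nonZero : ∀ n → NonZero (u n)
        u-nonZero n = >-nonZero (u-positive n)
    product-recurrent-from-1 {u} {D} u-positive u-≍ (suc n) =
      ≍-mono (≤-trans (m≤m+n D (u 2)) (m≤m+n _ (u 1 * u 0))) (u-≍ n)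

  open Comparability

  module GoldenGrowth (u : ℕ → ℕ) (1≤u₀ : 1 ≤ u 0) (u-mono : ∀ n → u n ≤ u (suc n))
                      (D : ℕ) (u-product-recurrent : ProductRecurrent D u) where
    open GoldenRatio
    open ≤-Reasoning

    private
      swap-middle : ∀ a b c d → a * b * (c * d) ≡ a * c * (b * d)
      swap-middle = solve-∀

      ^-distrib-* : ∀ a b n → (a * b) ^ n ≡ a ^ n * b ^ n
      ^-distrib-* a b zero = refl
      ^-distrib-* a b (suc n) = trans (cong (a * b *_) (^-distrib-* a b n)) (swap-middle a b (a ^ n) (b ^ n))

    u-nonZero : ∀ n → NonZero (u n)
    u-nonZero n = >-nonZero (positive n)
      where
        positive : ∀ n → 1 ≤ u n
        positive zero = 1≤u₀
        positive (suc n) = ≤-trans (positive n) (u-mono n)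

    E : ℕ
    E = suc (D + u 0 + u 1)

    D≤E : D ≤ E
    D≤E = m≤n⇒m≤1+n (≤-trans (m≤m+n D (u 0)) (m≤m+n (D + u 0) (u 1)))

    u₀≤E : u 0 ≤ E
    u₀≤E = m≤n⇒m≤1+n (≤-trans (m≤n+m (u 0) D) (m≤m+n (D + u 0) (u 1)))

    u₁≤E : u 1 ≤ E
    u₁≤E = m≤n⇒m≤1+n (m≤n+m (u 1) (D + u 0))

    u^-nonZero : ∀ n p → NonZero (u n ^ p)
    u^-nonZero n p = m^n≢0 (u n) p {{u-nonZero n}}

    ≤*u^ : ∀ {m} n p → m ≤ m * u n ^ p
    ≤*u^ {m} n p = m≤m*n m (u n ^ p) {{u^-nonZero n p}}

    mutual
      upper : ∀ n p q → γ< p / q → u (suc n) ^ q ≤ E ^ (p + q) * u n ^ p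
      upper zero p q _ = begin
        u 1 ^ q             ≤⟨ ^-monoˡ-≤ q u₁≤E ⟩
        E ^ q               ≤⟨ ^-monoʳ-≤ E (m≤n+m q p) ⟩
        E ^ (p + q)         ≤⟨ ≤*u^ 0 p ⟩
        E ^ (p + q) * u 0 ^ p ∎
      upper (suc n) p q γ<p/q with m≤n⇒∃[o]m+o≡n (γ<⇒≤ p q γ<p/q)
      ... | r , refl = begin
        u (2 + n) ^ q                                   ≤⟨ ^-monoˡ-≤ q (proj₁ (u-product-recurrent n)) ⟩
        (D * (u (1 + n) * u n)) ^ q                     ≡⟨ trans (^-distrib-* D _ q) (cong (D ^ q *_) (^-distrib-* (u (1 + n)) (u n) q)) ⟩
        D ^ q * (u (1 + n) ^ q * u n ^ q)               ≤⟨ *-monoʳ-≤ (D ^ q) (*-monoʳ-≤ (u (1 + n) ^ q) (lower n q r (γ<-step q r γ<p/q))) ⟩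
        D ^ q * (u (1 + n) ^ q * (E ^ (q + r) * u (1 + n) ^ r)) ≡⟨ rearrange (D ^ q) (u (1 + n) ^ q) (E ^ (q + r)) (u (1 + n) ^ r) ⟩
        D ^ q * E ^ (q + r) * (u (1 + n) ^ q * u (1 + n) ^ r) ≤⟨ *-monoˡ-≤ _ (*-monoˡ-≤ _ (^-monoˡ-≤ q D≤E)) ⟩
        E ^ q * E ^ (q + r) * (u (1 + n) ^ q * u (1 + n) ^ r) ≡⟨ cong₂ _*_ (trans (sym (^-distribˡ-+-* E q (q + r))) (cong (E ^_) (+-comm q (q + r)))) (sym (^-distribˡ-+-* (u (1 + n)) q r)) ⟩
        E ^ ((q + r) + q) * u (1 + n) ^ (q + r)         ∎
        where
          rearrange : ∀ a b c d → a * (b * (c * d)) ≡ a * c * (b * d)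
          rearrange = solve-∀

      lower : ∀ n p q → p / q <γ → u n ^ p ≤ E ^ (p + q) * u (suc n) ^ q
      lower zero p q _ = begin
        u 0 ^ p             ≤⟨ ^-monoˡ-≤ p u₀≤E ⟩
        E ^ p               ≤⟨ ^-monoʳ-≤ E (m≤m+n p q) ⟩
        E ^ (p + q)         ≤⟨ ≤*u^ 1 q ⟩
        E ^ (p + q) * u 1 ^ q ∎
      lower (suc n) p q p/q<γ with p ≤? q
      ... | yes p≤q = begin
        u (1 + n) ^ p                 ≤⟨ ^-monoʳ-≤ (u (1 + n)) {{u-nonZero (1 + n)}} p≤q ⟩
        u (1 + n) ^ q                 ≤⟨ ^-monoˡ-≤ q (u-mono (1 + n)) ⟩
        u (2 + n) ^ q                 ≤⟨ m≤n*m (u (2 + n) ^ q) (E ^ (p + q)) {{m^n≢0 E (p + q)}} ⟩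
        E ^ (p + q) * u (2 + n) ^ q   ∎
      ... | no p≰q with m≤n⇒∃[o]m+o≡n (<⇒≤ (≰⇒> p≰q))
      ... | r , refl = begin
        u (1 + n) ^ (q + r)                          ≡⟨ ^-distribˡ-+-* (u (1 + n)) q r ⟩
        u (1 + n) ^ q * u (1 + n) ^ r                ≤⟨ *-monoʳ-≤ (u (1 + n) ^ q) (upper n q r (<γ-step q r p/q<γ)) ⟩
        u (1 + n) ^ q * (E ^ (q + r) * u n ^ q)      ≡⟨ rearrange (u (1 + n) ^ q) (E ^ (q + r)) (u n ^ q) ⟩
        E ^ (q + r) * (u (1 + n) ^ q * u n ^ q)      ≡⟨ cong (E ^ (q + r) *_) (sym (^-distrib-* (u (1 + n)) (u n) q)) ⟩
        E ^ (q + r) * (u (1 + n) * u n) ^ q          ≤⟨ *-monoʳ-≤ (E ^ (q + r)) (^-monoˡ-≤ q (proj₂ (u-product-recurrent n))) ⟩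
        E ^ (q + r) * (D * u (2 + n)) ^ q            ≡⟨ cong (E ^ (q + r) *_) (^-distrib-* D (u (2 + n)) q) ⟩
        E ^ (q + r) * (D ^ q * u (2 + n) ^ q)        ≤⟨ *-monoʳ-≤ (E ^ (q + r)) (*-monoˡ-≤ (u (2 + n) ^ q) (^-monoˡ-≤ q D≤E)) ⟩
        E ^ (q + r) * (E ^ q * u (2 + n) ^ q)        ≡⟨ trans (sym (*-assoc (E ^ (q + r)) (E ^ q) _)) (cong (_* u (2 + n) ^ q) (sym (^-distribˡ-+-* E (q + r) q))) ⟩
        E ^ ((q + r) + q) * u (2 + n) ^ q            ∎
        where
          rearrange : ∀ a b c → a * (b * c) ≡ b * (a * c)
          rearrange = solve-∀

    K : ℕ
    K = E * E * E

    E≤K : E ≤ K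
    E≤K = m≤n*m E (E * E)

    E^≤K^ : ∀ p q → p < q + q → E ^ (p + q) ≤ K ^ q
    E^≤K^ p q p<2q = begin
      E ^ (p + q)           ≤⟨ ^-monoʳ-≤ E (+-monoˡ-≤ q (<⇒≤ p<2q)) ⟩
      E ^ (q + q + q)       ≡⟨ trans (^-distribˡ-+-* E (q + q) q) (cong (_* E ^ q) (^-distribˡ-+-* E q q)) ⟩
      E ^ q * E ^ q * E ^ q ≡⟨ sym (trans (^-distrib-* (E * E) E q) (cong (_* E ^ q) (^-distrib-* E E q))) ⟩
      K ^ q                 ∎

    u-square-bound : ∀ n → u (suc n) ≤ E * (u n * u n)
    u-square-bound zero = ≤-trans u₁≤E (m≤m*n E (u 0 * u 0) {{m*n≢0 (u 0) (u 0) {{u-nonZero 0}} {{u-nonZero 0}}}})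
    u-square-bound (suc n) = begin
      u (2 + n)                   ≤⟨ proj₁ (u-product-recurrent n) ⟩
      D * (u (1 + n) * u n)       ≤⟨ *-mono-≤ D≤E (*-monoʳ-≤ (u (1 + n)) (u-mono n)) ⟩
      E * (u (1 + n) * u (1 + n)) ∎

    ≍^γ-bound : Σ ℕ λ K → 1 ≤ K × (∀ n → u (suc n) ≍[ K ] u n ^γ)
    ≍^γ-bound = K , 1≤K , λ n → upper-γ n , lower-γ n
      where
        1≤K : 1 ≤ K
        1≤K = ≤-trans (s≤s z≤n) E≤K

        -- E ^ (p + q) ≤ K ^ q needs p < 2q; beyond that u (suc n) ≤ E * (u n * u n) suffices.
        upper-γ : ∀ n → u (suc n) ≤[ K ]· u n ^γ
        upper-γ n p q _ γ<p/q with q + q ≤? p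
        ... | yes 2q≤p = begin
          u (suc n) ^ q               ≤⟨ ^-monoˡ-≤ q (u-square-bound n) ⟩
          (E * (u n * u n)) ^ q       ≡⟨ trans (^-distrib-* E (u n * u n) q) (cong (E ^ q *_) (trans (^-distrib-* (u n) (u n) q) (sym (^-distribˡ-+-* (u n) q q)))) ⟩
          E ^ q * u n ^ (q + q)       ≤⟨ *-mono-≤ (^-monoˡ-≤ q E≤K) (^-monoʳ-≤ (u n) {{u-nonZero n}} 2q≤p) ⟩
          K ^ q * u n ^ p             ∎
        ... | no 2q≰p = ≤-trans (upper n p q γ<p/q) (*-monoˡ-≤ (u n ^ p) (E^≤K^ p q (≰⇒> 2q≰p)))

        lower-γ : ∀ n → u n ^γ≤[ K ]· u (suc n)
        lower-γ n p q _ p/q<γ =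
          ≤-trans (lower n p q p/q<γ) (*-monoˡ-≤ (u (suc n) ^ q) (E^≤K^ p q (<γ⇒<2* p q p/q<γ)))

  product-recurrent⇒≍^γ : ∀ (u : ℕ → ℕ) D → 1 ≤ u 0 → (∀ n → u n ≤ u (suc n)) → ProductRecurrent D u →
                          Σ ℕ λ K → 1 ≤ K × (∀ n → u (suc n) ≍[ K ] u n ^γ)
  product-recurrent⇒≍^γ u D 1≤u₀ u-mono u-product-recurrent =
    GoldenGrowth.≍^γ-bound u 1≤u₀ u-mono D u-product-recurrent

  ∑ : ℕ → (ℕ → ℕ) → ℕ
  ∑ zero    g = 0
  ∑ (suc k) g = g k + ∑ k g

  ≤∑ : ∀ g {j k} → j < k → g j ≤ ∑ k g
  ≤∑ g {j} {suc k} j<1+k with m≤n⇒m<n∨m≡n (s≤s⁻¹ j<1+k)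
  ... | inj₁ j<k  = ≤-trans (≤∑ g j<k) (m≤n+m (∑ k g) (g k))
  ... | inj₂ refl = m≤m+n (g j) (∑ j g)

  module SlackArithmetic where
    open ≤-Reasoning

    upper-slack-step : ∀ M X Y Z a b c d →
      X ≤ b * Y + Z → Y * b + M * c ≤ M * c * b → Z ≤ M * a → d + a ≡ c * b → b + (a + a) ≤ c →
      X * c + M * d ≤ M * d * c
    upper-slack-step M X Y Z a b c d X≤ Y≤ Z≤ d+a≡cb b+2a≤c = +-cancelʳ-≤ (c * (M * c)) _ _ (begin
      X * c + M * d + c * (M * c)             ≤⟨ +-monoˡ-≤ _ (+-monoˡ-≤ _ (*-monoˡ-≤ c X≤)) ⟩
      (b * Y + Z) * c + M * d + c * (M * c)   ≡⟨ solve (M ∷ Y ∷ Z ∷ b ∷ c ∷ d ∷ []) ⟩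
      c * (Y * b + M * c) + (Z * c + M * d)   ≤⟨ +-mono-≤ (*-monoʳ-≤ c Y≤) (+-monoˡ-≤ _ (*-monoˡ-≤ c Z≤)) ⟩
      c * (M * c * b) + (M * a * c + M * d)   ≡⟨ solve (M ∷ a ∷ b ∷ c ∷ d ∷ []) ⟩
      M * c * (c * b) + M * (a * c + d)       ≡⟨ cong (λ e → M * c * e + M * (a * c + d)) (sym d+a≡cb) ⟩
      M * c * (d + a) + M * (a * c + d)       ≡⟨ solve (M ∷ a ∷ c ∷ d ∷ []) ⟩
      M * d * c + M * (c * (a + a) + d)       ≤⟨ +-monoʳ-≤ (M * d * c) (*-monoʳ-≤ M (+-monoʳ-≤ (c * (a + a)) (m+n≤o⇒m≤o d (≤-reflexive d+a≡cb)))) ⟩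
      M * d * c + M * (c * (a + a) + c * b)   ≡⟨ solve (M ∷ a ∷ b ∷ c ∷ d ∷ []) ⟩
      M * d * c + M * (c * (b + (a + a)))     ≤⟨ +-monoʳ-≤ (M * d * c) (*-monoʳ-≤ M (*-monoʳ-≤ c b+2a≤c)) ⟩
      M * d * c + M * (c * c)                 ≡⟨ solve (M ∷ c ∷ d ∷ []) ⟩
      M * d * c + c * (M * c)                 ∎)

    square-slack : ∀ σ s′ → 2 ≤ σ → suc σ + suc σ ≤ s′ → suc σ * suc σ * (s′ + 6) ≤ s′ * (σ * (suc σ + 6))
    square-slack σ s′ 2≤σ 2s≤s′ with m≤n⇒∃[o]m+o≡n 2≤σ
    ... | α , refl with m≤n⇒∃[o]m+o≡n 2s≤s′
    ... | τ , refl = ≤-trans (m≤m+n _ _) (≤-reflexive (certificate α τ))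
      where
        certificate : ∀ α τ → (3 + α) * (3 + α) * ((3 + α) + (3 + α) + τ + 6) + (12 * α + 4 * α * α + τ * (9 + 5 * α))
                              ≡ ((3 + α) + (3 + α) + τ) * ((2 + α) * (3 + α + 6))
        certificate = solve-∀

    lower-slack-step : ∀ R a a′ s s′ s″ →
      3 ≤ s → s + s ≤ s′ → s″ ≤ s′ * s → s * a ≤ a′ + a → s′ * (s + 6) ≤ R * a * s →
      s″ * (s′ + 6) ≤ R * a′ * s′
    lower-slack-step R a a′ (suc σ) s′ s″ (s≤s 2≤σ) 2s≤s′ s″≤ sa≤ hyp = *-cancelˡ-≤ (suc σ) (begin
      suc σ * (s″ * (s′ + 6))                   ≤⟨ *-monoʳ-≤ (suc σ) (*-monoˡ-≤ (s′ + 6) s″≤) ⟩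
      suc σ * (s′ * suc σ * (s′ + 6))           ≡⟨ solve (σ ∷ s′ ∷ []) ⟩
      s′ * (suc σ * suc σ * (s′ + 6))           ≤⟨ *-monoʳ-≤ s′ (square-slack σ s′ 2≤σ 2s≤s′) ⟩
      s′ * (s′ * (σ * (suc σ + 6)))             ≡⟨ solve (σ ∷ s′ ∷ []) ⟩
      σ * s′ * (s′ * (suc σ + 6))               ≤⟨ *-monoʳ-≤ (σ * s′) hyp ⟩
      σ * s′ * (R * a * suc σ)                  ≡⟨ solve (R ∷ a ∷ σ ∷ s′ ∷ []) ⟩
      suc σ * (R * (σ * a) * s′)                ≤⟨ *-monoʳ-≤ (suc σ) (*-monoˡ-≤ s′ (*-monoʳ-≤ R σa≤a′)) ⟩
      suc σ * (R * a′ * s′)                     ∎)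
      where
        σa≤a′ : σ * a ≤ a′
        σa≤a′ = +-cancelˡ-≤ a _ _ (≤-trans sa≤ (≤-reflexive (+-comm a′ a)))

  module ComparableSequences
    (t A : ℕ → ℕ)
    (1≤t₀ : 1 ≤ t 0) (t-increasing : ∀ n → t n < t (suc n))
    (t-rec : ∀ n → t (3 + n) + t n ≡ t (2 + n) * t (1 + n))
    (1≤A₀ : 1 ≤ A 0) (A₀<A₁ : A 0 < A 1) (A₁<A₂ : A 1 < A 2)
    (A-rec-upper : ∀ n → A (3 + n) ≤ t (2 + n) * A (2 + n) + A n)
    (A-rec-lower : ∀ n → t (2 + n) * A (2 + n) ≤ A (3 + n) + A n)
    where
    open ≤-Reasoning
    open SlackArithmetic

    private
      double : ∀ x → x + x ≡ 2 * x
      double = solve-∀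

      triple : ∀ x → x + x + x ≡ 3 * x
      triple = solve-∀

    n<t : ∀ n → n < t n
    n<t zero    = 1≤t₀
    n<t (suc n) = ≤-<-trans (n<t n) (t-increasing n)

    k<t[k+n] : ∀ k n → k < t (k + n)
    k<t[k+n] k n = ≤-<-trans (m≤m+n k n) (n<t (k + n))

    t-positive : ∀ n → 1 ≤ t n
    t-positive n = ≤-trans (s≤s z≤n) (n<t n)

    t-≍-product : ∀ n → t (3 + n) ≍[ 2 ] (t (2 + n) * t (1 + n))
    t-≍-product n =
        ≤-trans (m+n≤o⇒m≤o (t (3 + n)) (≤-reflexive (t-rec n))) (m≤n*m _ 2)
      , (begin
        t (2 + n) * t (1 + n)   ≡⟨ sym (t-rec n) ⟩
        t (3 + n) + t n         ≤⟨ +-monoʳ-≤ (t (3 + n)) (<⇒≤ (<-trans (t-increasing n) (<-trans (t-increasing (1 + n)) (t-increasing (2 + n))))) ⟩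
        t (3 + n) + t (3 + n)   ≡⟨ double (t (3 + n)) ⟩
        2 * t (3 + n)           ∎)

    t-doubling : ∀ n → t (3 + n) + t (3 + n) ≤ t (4 + n)
    t-doubling n = +-cancelʳ-≤ (t (1 + n)) _ _ (begin
      t (3 + n) + t (3 + n) + t (1 + n)  ≤⟨ +-monoʳ-≤ (t (3 + n) + t (3 + n)) (<⇒≤ (<-trans (t-increasing (1 + n)) (t-increasing (2 + n)))) ⟩
      t (3 + n) + t (3 + n) + t (3 + n)  ≡⟨ triple (t (3 + n)) ⟩
      3 * t (3 + n)                      ≤⟨ *-monoˡ-≤ (t (3 + n)) (k<t[k+n] 2 n) ⟩
      t (2 + n) * t (3 + n)              ≡⟨ *-comm (t (2 + n)) (t (3 + n)) ⟩
      t (3 + n) * t (2 + n)              ≡⟨ sym (t-rec (1 + n)) ⟩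
      t (4 + n) + t (1 + n)              ∎)

    A-increasing : ∀ n → A n < A (suc n)
    A-increasing zero = A₀<A₁
    A-increasing (suc zero) = A₁<A₂
    A-increasing (suc (suc n)) = +-cancelʳ-< (A (2 + n)) (A (2 + n)) (A (3 + n)) (begin-strict
      A (2 + n) + A (2 + n)    ≡⟨ double (A (2 + n)) ⟩
      2 * A (2 + n)            ≤⟨ *-monoˡ-≤ (A (2 + n)) (k<t[k+n] 1 (1 + n)) ⟩
      t (2 + n) * A (2 + n)    ≤⟨ A-rec-lower n ⟩
      A (3 + n) + A n          <⟨ +-monoʳ-< (A (3 + n)) (<-trans (A-increasing n) (A-increasing (suc n))) ⟩
      A (3 + n) + A (2 + n)    ∎)

    A-positive : ∀ n → 1 ≤ A n
    A-positive zero    = 1≤A₀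
    A-positive (suc n) = ≤-trans (A-positive n) (<⇒≤ (A-increasing n))

    M : ℕ
    M = ∑ 4 (λ j → A (1 + j) * t (1 + j))

    -- A (1 + j) / t (2 + j) ≤ M (1 − 1 / t (1 + j)): the slack absorbs the error term A n of A-rec-upper.
    UpperSlack : ℕ → Set
    UpperSlack j = A (1 + j) * t (1 + j) + M * t (2 + j) ≤ M * t (2 + j) * t (1 + j)

    upper-slack-base : ∀ j → j < 4 → UpperSlack j
    upper-slack-base j j<4 = begin
      A (1 + j) * t (1 + j) + M * t (2 + j)   ≤⟨ +-monoˡ-≤ _ (≤-trans (≤∑ (λ i → A (1 + i) * t (1 + i)) j<4) (m≤m*n M (t (2 + j)) {{>-nonZero (t-positive (2 + j))}})) ⟩
      M * t (2 + j) + M * t (2 + j)           ≡⟨ trans (double (M * t (2 + j))) (*-comm 2 (M * t (2 + j))) ⟩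
      M * t (2 + j) * 2                       ≤⟨ *-monoʳ-≤ (M * t (2 + j)) (k<t[k+n] 1 j) ⟩
      M * t (2 + j) * t (1 + j)               ∎

    UpperSlack⇒A-upper : ∀ j → UpperSlack j → A (1 + j) ≤ M * t (2 + j)
    UpperSlack⇒A-upper j slack = *-cancelʳ-≤ _ _ (t (1 + j)) {{>-nonZero (t-positive (1 + j))}} (m+n≤o⇒m≤o _ slack)

    -- t-doubling starts at t 3, which fixes the number of base cases here and in lower-slack.
    upper-slack : ∀ j → UpperSlack j
    upper-slack 0 = upper-slack-base 0 (s≤s z≤n)
    upper-slack 1 = upper-slack-base 1 (s≤s (s≤s z≤n))
    upper-slack 2 = upper-slack-base 2 (s≤s (s≤s (s≤s z≤n)))
    upper-slack 3 = upper-slack-base 3 ≤-refl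
    upper-slack (suc (suc (suc (suc n)))) =
      upper-slack-step M (A (5 + n)) (A (4 + n)) (A (2 + n)) (t (3 + n)) (t (4 + n)) (t (5 + n)) (t (6 + n))
        (A-rec-upper (2 + n)) (upper-slack (suc (suc (suc n)))) (UpperSlack⇒A-upper (1 + n) (upper-slack (suc n)))
        (t-rec (3 + n)) (≤-trans (+-monoʳ-≤ (t (4 + n)) (t-doubling n)) (t-doubling (1 + n)))

    A-upper : ∀ n → A (1 + n) ≤ M * t (2 + n)
    A-upper n = UpperSlack⇒A-upper n (upper-slack n)

    R : ℕ
    R = ∑ 3 (λ j → t (2 + j) * (t (1 + j) + 6))

    -- A (1 + j) / t (2 + j) ≥ (1 + 6 / t (1 + j)) / R: each step costs a factor 1 − 1 / t (1 + j),
    -- which the shrinking slack pays for.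
    LowerSlack : ℕ → Set
    LowerSlack j = t (2 + j) * (t (1 + j) + 6) ≤ R * A (1 + j) * t (1 + j)

    lower-slack-base : ∀ j → j < 3 → LowerSlack j
    lower-slack-base j j<3 = begin
      t (2 + j) * (t (1 + j) + 6)   ≤⟨ ≤∑ (λ i → t (2 + i) * (t (1 + i) + 6)) j<3 ⟩
      R                             ≤⟨ m≤m*n R (A (1 + j)) {{>-nonZero (A-positive (1 + j))}} ⟩
      R * A (1 + j)                 ≤⟨ m≤m*n (R * A (1 + j)) (t (1 + j)) {{>-nonZero (t-positive (1 + j))}} ⟩
      R * A (1 + j) * t (1 + j)     ∎

    lower-slack : ∀ j → LowerSlack j
    lower-slack 0 = lower-slack-base 0 (s≤s z≤n)
    lower-slack 1 = lower-slack-base 1 (s≤s (s≤s z≤n))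
    lower-slack 2 = lower-slack-base 2 ≤-refl
    lower-slack (suc (suc (suc n))) =
      lower-slack-step R (A (3 + n)) (A (4 + n)) (t (3 + n)) (t (4 + n)) (t (5 + n))
        (k<t[k+n] 2 (1 + n)) (t-doubling n)
        (m+n≤o⇒m≤o _ (≤-reflexive (t-rec (2 + n))))
        (≤-trans (A-rec-lower (1 + n)) (+-monoʳ-≤ (A (4 + n)) (<⇒≤ (<-trans (A-increasing (1 + n)) (A-increasing (2 + n))))))
        (lower-slack (suc (suc n)))

    A-lower : ∀ n → t (2 + n) ≤ R * A (1 + n)
    A-lower n = *-cancelʳ-≤ _ _ (t (1 + n)) {{>-nonZero (t-positive (1 + n))}} (begin
      t (2 + n) * t (1 + n)         ≤⟨ *-monoʳ-≤ (t (2 + n)) (m≤m+n (t (1 + n)) 6) ⟩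
      t (2 + n) * (t (1 + n) + 6)   ≤⟨ lower-slack n ⟩
      R * A (1 + n) * t (1 + n)     ∎)

    C : ℕ
    C = M + R

    A-≍-t : ∀ n → A (1 + n) ≍[ C ] t (2 + n)
    A-≍-t n = ≤-trans (A-upper n) (*-monoˡ-≤ (t (2 + n)) (m≤m+n M R))
            , ≤-trans (A-lower n) (*-monoˡ-≤ (A (1 + n)) (m≤n+m R M))

    Dₜ : ℕ
    Dₜ = 2 + t 2 + t 1 * t 0

    t-product-recurrent : ProductRecurrent Dₜ t
    t-product-recurrent = product-recurrent-from-1 {t} {2} t-positive t-≍-product

    A-≍-product : ∀ n → A (3 + n) ≍[ C * 2 * (C * C) ] (A (2 + n) * A (1 + n))
    A-≍-product n = ≍-trans {K = C * 2} (≍-trans {K = C} (A-≍-t (2 + n)) (t-≍-product (1 + n)))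
                                        (≍-* {K = C} {L = C} (≍-sym {K = C} (A-≍-t (1 + n))) (≍-sym {K = C} (A-≍-t n)))

    Dₐ : ℕ
    Dₐ = C * 2 * (C * C) + A 2 + A 1 * A 0

    A-product-recurrent : ProductRecurrent Dₐ A
    A-product-recurrent = product-recurrent-from-1 {A} {C * 2 * (C * C)} A-positive A-≍-product

open Naturals
open Naturals.Comparability

lemma5p2 : (f : QForm) (a b c : V3) →
    φ f a ≡ + 1 → φ f b ≡ + 1 → φ f c ≡ + 1 →
    + 1 ≤ℤ T f a b c 0 → T f a b c 0 <ℤ T f a b c 1 → T f a b c 1 <ℤ T f a b c 2 →
    1 ≤ ‖ a ‖ → ‖ a ‖ < ‖ b ‖ → ‖ b ‖ < ‖ c ‖ →
    ((n : ℕ) → + 1 ≤ℤ T f a b c n × T f a b c n <ℤ T f a b c (suc n)) ×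
    ((n : ℕ) → 1 ≤ ‖ Y f a b c n ‖ × ‖ Y f a b c n ‖ < ‖ Y f a b c (suc n) ‖) ×
    Σ ℕ (λ K → 1 ≤ K ×
      ((n : ℕ) →
        (∣ T f a b c (suc n) ∣ ≍[ K ] ∣ T f a b c n ∣ ^γ) ×
        (‖ Y f a b c (suc n) ‖ ≍[ K ] ∣ T f a b c (suc (suc n)) ∣) ×
        (‖ Y f a b c (suc n) ‖ ≍[ K ] ‖ Y f a b c n ‖ ^γ)))
lemma5p2 f a b c φa≡1 φb≡1 φc≡1 1≤T₀ T₀<T₁ T₁<T₂ 1≤‖a‖ ‖a‖<‖b‖ ‖b‖<‖c‖ =
  let open IntegerSequences f a b c φa≡1 φb≡1 φc≡1 1≤T₀ T₀<T₁ T₁<T₂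
      ‖Y‖ = λ n → ‖ Y f a b c n ‖
      open ComparableSequences tℕ ‖Y‖ 1≤tℕ₀ tℕ-increasing tℕ-rec 1≤‖a‖ ‖a‖<‖b‖ ‖b‖<‖c‖ ‖Y‖-rec-upper ‖Y‖-rec-lower
      (Kₜ , 1≤Kₜ , t-γ) = product-recurrent⇒≍^γ tℕ Dₜ 1≤tℕ₀ (λ n → ℕ.<⇒≤ (tℕ-increasing n)) t-product-recurrent
      (Kₐ , _ , A-γ) = product-recurrent⇒≍^γ ‖Y‖ Dₐ 1≤‖a‖ (λ n → ℕ.<⇒≤ (A-increasing n)) A-product-recurrent
      Kₜ≤K = ℕ.≤-trans (ℕ.m≤m+n Kₜ Kₐ) (ℕ.m≤m+n (Kₜ ℕ.+ Kₐ) C)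
      Kₐ≤K = ℕ.≤-trans (ℕ.m≤n+m Kₐ Kₜ) (ℕ.m≤m+n (Kₜ ℕ.+ Kₐ) C)
      C≤K = ℕ.m≤n+m C (Kₜ ℕ.+ Kₐ)
  in  T-increasing
    , (λ n → A-positive n , A-increasing n)
    , Kₜ ℕ.+ Kₐ ℕ.+ C , ℕ.≤-trans 1≤Kₜ Kₜ≤K
    , λ n → ≍^γ-mono Kₜ≤K (t-γ n) , ≍-mono C≤K (A-≍-t n) , ≍^γ-mono Kₐ≤K (A-γ n)
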